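{- Let $D=\{1,\dots,k\}$, $D'=\{0\}\cup D$ and let $\pi$ be a permutation of $D$. The function $f:D'^2\to\mathbb{R}$ given by $f(x,y)=0$ if $x,y\in D$ and $x=\pi(y)$, $f(x,y)=1$ if $x,y\in D$ and $x\ne\pi(y)$, $f(0,0)=0$, and $f(a,0)=f(0,a)=1/2$ for $a\in D$, is $k$-submodular representable.
   Context: For a variable set $X$ and $v\in X$, $X_v=\{v_i:i\in D\}$; an $(X,k)$-network is a network with capacities $c\ge0$ on vertices $\{s,t\}\cup\bigcup_v X_v$; the capacity of an $s$-$t$ cut $S$ is the total capacity of edges leaving $S$. For $\phi:X\to D'$, $S_\phi=\{s\}\cup\{v_{\phi(v)}:\phi(v)\ne0\}$; $\nu(S)=\{s\}\cup\{v_i:S\cap X_v=\{v_i\}\}$. A network represents $f$ if $c(S_\phi)=f(\phi)$ for all $\phi$, and is $k$-submodular if $c(S)\ge c(\nu(S))$ for all $s$-$t$ cuts $S$. $f$ is $k$-submodular representable if some $k$-submodular $(X,k)$-network represents it (here $X$ is the two-variable set $\{x,y\}$). -}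

module Defs where

open import Data.Nat using (ℕ; zero; suc)
open import Data.Fin using (Fin; zero; suc; _≟_)
open import Data.Fin.Permutation using (Permutation′; _⟨$⟩ʳ_)
open import Data.Bool using (Bool; true; false; _∧_; _∨_; not; if_then_else_)
open import Data.List using (List; []; _∷_; _++_; map; concatMap; foldr)
open import Data.List using (allFin)
open import Data.Rational using (ℚ; 0ℚ; 1ℚ; ½; _+_; _≤_)
open import Data.Product using (Σ; _×_; _,_)
open import Relation.Binary.PropositionalEquality using (_≡_)
open import Relation.Nullary.Decidable using (⌊_⌋)

-- D  = {1,…,k}       is modelled by  Fin k        (i : Fin k stands for i+1)
-- D' = {0} ∪ D       is modelled by  Fin (suc k)  (zero = 0, suc i = i+1)
-- Variable set X = {x, y} is modelled by Fin 2 (zero = x, suc zero = y).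

data Vertex (X : ℕ) (k : ℕ) : Set where
  s t  : Vertex X k
  node : Fin X → Fin k → Vertex X k

allVertices : (X k : ℕ) → List (Vertex X k)
allVertices X k = s ∷ t ∷ concatMap (λ v → map (node v) (allFin k)) (allFin X)

record Network (X k : ℕ) : Set where
  field
    cap    : Vertex X k → Vertex X k → ℚ
    capNonneg : ∀ u w → 0ℚ ≤ cap u w

VSet : ℕ → ℕ → Set
VSet X k = Vertex X k → Bool

IsCut : ∀ {X k} → VSet X k → Set
IsCut S = (S s ≡ true) × (S t ≡ false)

allB : ∀ {A : Set} → (A → Bool) → List A → Bool
allB p = foldr (λ a b → p a ∧ b) true

sumℚ : List ℚ → ℚ
sumℚ = foldr _+_ 0ℚ

capacity : ∀ {X k} → Network X k → VSet X k → ℚ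
capacity {X} {k} N S =
  sumℚ (concatMap (λ u → map (λ w → if S u ∧ not (S w) then Network.cap N u w else 0ℚ)
                              (allVertices X k))
                  (allVertices X k))

Sφ : ∀ {X k} → (Fin X → Fin (suc k)) → VSet X k
Sφ φ s = true
Sφ φ t = false
Sφ φ (node v i) = ⌊ φ v ≟ suc i ⌋

-- ν(S) = {s} ∪ { v_i : S ∩ X_v = {v_i} }
ν : ∀ {X k} → VSet X k → VSet X k
ν S s = true
ν S t = false
ν {X} {k} S (node v i) = S (node v i) ∧ allB (λ j → ⌊ j ≟ i ⌋ ∨ not (S (node v j))) (allFin k)

Represents : ∀ {X k} → Network X k → ((Fin X → Fin (suc k)) → ℚ) → Set
Represents N f = ∀ φ → capacity N (Sφ φ) ≡ f φ

IsKSubmodular : ∀ {X k} → Network X k → Set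
IsKSubmodular N = ∀ S → IsCut S → capacity N (ν S) ≤ capacity N S

KSubmodularRepresentable : (X k : ℕ) → ((Fin X → Fin (suc k)) → ℚ) → Set
KSubmodularRepresentable X k f =
  Σ (Network X k) (λ N → IsKSubmodular N × Represents N f)

fπ : ∀ {k} → Permutation′ k → Fin (suc k) → Fin (suc k) → ℚ
fπ π zero    zero    = 0ℚ
fπ π zero    (suc a) = ½
fπ π (suc a) zero    = ½
fπ π (suc a) (suc b) = if ⌊ a ≟ π ⟨$⟩ʳ b ⌋ then 0ℚ else 1ℚ

fπ-on : ∀ {k} → Permutation′ k → (Fin 2 → Fin (suc k)) → ℚ
fπ-on π φ = fπ π (φ zero) (φ (suc zero))

-- The representing network is the "matching network" of π: for every i ∈ D it
-- has an edge x_i → y_{π⁻¹ i} and an edge y_j → x_{π j}, all of capacity ½.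
-- (1) For any maps σ τ on Fin k, the capacity of a cut in the matching network
--     of σ, τ is ½ times the number of its edges leaving the cut
--     (capacity-cutEdges), a ℕ-valued quantity cutEdges.
-- (2) Representation: S_φ for φ = (a, b) selects at most one node per
--     variable, and counting its leaving edges gives f_π(a, b) (cutEdges-chosen).
-- (3) k-submodularity: ν restricts the part of a cut on each variable to a
--     singleton or to ∅ (sole); for mutually inverse σ τ a case analysis on
--     which parts survive shows cutEdges never increases (cutEdges-ν).
module Submission where

open import Defs
open import Data.Nat using (ℕ)
open import Data.Fin.Permutation using (Permutation′; _⟨$⟩ʳ_; _⟨$⟩ˡ_; inverseˡ; inverseʳ)

open import Algebra.Bundles using (CommutativeMonoid)
import Algebra.Properties.CommutativeMonoid.Sum as MonoidSum
open import Data.Bool using (Bool; true; false; _∧_; _∨_; not; if_then_else_)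
open import Data.Bool.Properties using (∧-zeroʳ; ∧-identityʳ; ∨-identityˡ; ∧-conicalˡ; ∧-conicalʳ; ∨-conicalˡ; ∨-conicalʳ; not-injective; ¬-not)
import Data.Bool as Bool
open import Data.Fin using (Fin; zero; suc; _≟_; punchIn)
open import Data.Fin.Properties using (punchInᵢ≢i; suc-injective; any?)
open import Data.List using (List; []; _∷_; _++_; map; concat; concatMap; tabulate; allFin)
open import Data.List.Properties using (map-++; map-tabulate; map-∘; ++-identityʳ)
import Data.Nat as ℕ
import Data.Nat.Properties as ℕ
open import Data.Product using (∃; _×_; _,_)
open import Data.Rational using (ℚ; 0ℚ; 1ℚ; ½; _+_; _≤_; _≤?_)
import Data.Rational.Properties as ℚ
open import Data.Unit using (tt)
open import Function using (_∘_)
open import Relation.Binary.PropositionalEquality using (_≡_; refl; sym; trans; cong; cong₂; subst; subst₂; module ≡-Reasoning)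
open import Relation.Nullary using (¬_; yes; no; contradiction)
open import Data.Sum using (_⊎_; inj₁; inj₂)
open import Relation.Nullary.Decidable using (⌊_⌋; toWitness)

module SumLemmas {a ℓ} (M : CommutativeMonoid a ℓ) where
  open CommutativeMonoid M
    using (Carrier; _≈_; setoid; ∙-congˡ; identityʳ) renaming (_∙_ to _⊕_; ε to 0#)
  open MonoidSum M using (sum; sum-cong-≋; sum-replicate-zero; sum-remove)
  open import Relation.Binary.Reasoning.Setoid setoid

  sum-zero : ∀ {n} (f : Fin n → Carrier) → (∀ i → f i ≈ 0#) → sum f ≈ 0#
  sum-zero {n} f f≈0 = begin
    sum f                  ≈⟨ sum-cong-≋ {n} f≈0 ⟩
    sum {n} (λ _ → 0#)     ≈⟨ sum-replicate-zero n ⟩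
    0#                     ∎

  sum-single : ∀ {n} (f : Fin n → Carrier) (a : Fin n) →
               (∀ i → ¬ i ≡ a → f i ≈ 0#) → sum f ≈ f a
  sum-single {ℕ.suc n} f a vanish = begin
    sum f                                 ≈⟨ sum-remove f ⟩
    f a ⊕ sum (f ∘ punchIn a)             ≈⟨ ∙-congˡ (sum-zero _ (λ j → vanish _ (punchInᵢ≢i a j))) ⟩
    f a ⊕ 0#                              ≈⟨ identityʳ (f a) ⟩
    f a                                   ∎

½[_] : Bool → ℚ
½[ b ] = if b then ½ else 0ℚ

𝟙 : Bool → ℕ
𝟙 b = if b then 1 else 0

∑ : ∀ {n} → (Fin n → ℚ) → ℚ
∑ = MonoidSum.sum ℚ.+-0-commutativeMonoid

count : ∀ {n} → (Fin n → Bool) → ℕ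
count b = MonoidSum.sum ℕ.+-0-commutativeMonoid (𝟙 ∘ b)

open SumLemmas ℚ.+-0-commutativeMonoid using () renaming (sum-zero to ∑-zero; sum-single to ∑-single)

∑-cong : ∀ {n} {f g : Fin n → ℚ} → (∀ i → f i ≡ g i) → ∑ f ≡ ∑ g
∑-cong = MonoidSum.sum-cong-≗ ℚ.+-0-commutativeMonoid

count-cong : ∀ {n} {b c : Fin n → Bool} → (∀ i → b i ≡ c i) → count b ≡ count c
count-cong b≗c = MonoidSum.sum-cong-≗ ℕ.+-0-commutativeMonoid (cong 𝟙 ∘ b≗c)

count-none : ∀ {n} (b : Fin n → Bool) → (∀ i → b i ≡ false) → count b ≡ 0
count-none b none = SumLemmas.sum-zero ℕ.+-0-commutativeMonoid (𝟙 ∘ b) (cong 𝟙 ∘ none)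

count-single : ∀ {n} (b : Fin n → Bool) (a : Fin n) →
               (∀ i → ¬ i ≡ a → b i ≡ false) → count b ≡ 𝟙 (b a)
count-single b a vanish = SumLemmas.sum-single ℕ.+-0-commutativeMonoid (𝟙 ∘ b) a (λ i i≢a → cong 𝟙 (vanish i i≢a))

count-≤1 : ∀ {n} (b : Fin n → Bool) (a : Fin n) → (∀ i → ¬ i ≡ a → b i ≡ false) → count b ℕ.≤ 1
count-≤1 b a vanish rewrite count-single b a vanish with b a
... | true  = ℕ.≤-refl
... | false = ℕ.z≤n

count-≥1 : ∀ {n} (b : Fin n → Bool) (a : Fin n) → b a ≡ true → 1 ℕ.≤ count b
count-≥1 {ℕ.suc n} b a ba≡true
  rewrite MonoidSum.sum-remove ℕ.+-0-commutativeMonoid {i = a} (𝟙 ∘ b) | ba≡true = ℕ.s≤s ℕ.z≤n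

halves : ℕ → ℚ
halves ℕ.zero    = 0ℚ
halves (ℕ.suc n) = ½ + halves n

0≤½ : 0ℚ ≤ ½
0≤½ = toWitness {a? = 0ℚ ≤? ½} tt

½[]-nonneg : ∀ b → 0ℚ ≤ ½[ b ]
½[]-nonneg true  = 0≤½
½[]-nonneg false = ℚ.≤-refl

halves-+ : ∀ m n → halves (m ℕ.+ n) ≡ halves m + halves n
halves-+ ℕ.zero    n = sym (ℚ.+-identityˡ (halves n))
halves-+ (ℕ.suc m) n = trans (cong (½ +_) (halves-+ m n)) (sym (ℚ.+-assoc ½ (halves m) (halves n)))

halves-nonneg : ∀ n → 0ℚ ≤ halves n
halves-nonneg ℕ.zero    = ℚ.≤-refl
halves-nonneg (ℕ.suc n) = ℚ.+-mono-≤ 0≤½ (halves-nonneg n)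

halves-mono : ∀ {m n} → m ℕ.≤ n → halves m ≤ halves n
halves-mono {n = n} ℕ.z≤n = halves-nonneg n
halves-mono (ℕ.s≤s m≤n) = ℚ.+-monoʳ-≤ ½ (halves-mono m≤n)

∑-½[] : ∀ {n} (b : Fin n → Bool) → ∑ (λ i → ½[ b i ]) ≡ halves (count b)
∑-½[] {ℕ.zero}  b = refl
∑-½[] {ℕ.suc n} b with b zero
... | true  = cong (½ +_) (∑-½[] (b ∘ suc))
... | false = trans (ℚ.+-identityˡ _) (∑-½[] (b ∘ suc))

sumℚ-++ : (xs ys : List ℚ) → sumℚ (xs ++ ys) ≡ sumℚ xs + sumℚ ys
sumℚ-++ []       ys = sym (ℚ.+-identityˡ (sumℚ ys))
sumℚ-++ (x ∷ xs) ys = trans (cong (x +_) (sumℚ-++ xs ys)) (sym (ℚ.+-assoc x (sumℚ xs) (sumℚ ys)))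

sumℚ-concat : (xss : List (List ℚ)) → sumℚ (concat xss) ≡ sumℚ (map sumℚ xss)
sumℚ-concat []         = refl
sumℚ-concat (xs ∷ xss) = trans (sumℚ-++ xs (concat xss)) (cong (sumℚ xs +_) (sumℚ-concat xss))

sumℚ-tabulate : ∀ {n} (f : Fin n → ℚ) → sumℚ (tabulate f) ≡ ∑ f
sumℚ-tabulate {ℕ.zero}  f = refl
sumℚ-tabulate {ℕ.suc n} f = cong (f zero +_) (sumℚ-tabulate (f ∘ suc))

module Vertices {k : ℕ} where
  x y : Fin k → Vertex 2 k
  x = node zero
  y = node (suc zero)

  ∑V : (Vertex 2 k → ℚ) → ℚ
  ∑V R = sumℚ (map R (allVertices 2 k))

  ∑V-concatMap : (g : Vertex 2 k → Vertex 2 k → ℚ) →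
                 sumℚ (concatMap (λ u → map (g u) (allVertices 2 k)) (allVertices 2 k)) ≡ ∑V (λ u → ∑V (g u))
  ∑V-concatMap g = trans (sumℚ-concat (map (λ u → map (g u) (allVertices 2 k)) (allVertices 2 k)))
                         (cong sumℚ (sym (map-∘ {g = sumℚ} {f = λ u → map (g u) (allVertices 2 k)} (allVertices 2 k))))

  ∑V-zero : (R : Vertex 2 k → ℚ) → (∀ u → R u ≡ 0ℚ) → ∑V R ≡ 0ℚ
  ∑V-zero R R≡0 = go (allVertices 2 k)
    where
    go : (us : List (Vertex 2 k)) → sumℚ (map R us) ≡ 0ℚ
    go []       = refl
    go (u ∷ us) = trans (cong₂ _+_ (R≡0 u) (go us)) (ℚ.+-identityˡ 0ℚ)

  ∑V-nodes : (R : Vertex 2 k → ℚ) → R s ≡ 0ℚ → R t ≡ 0ℚ → ∑V R ≡ ∑ (R ∘ x) + ∑ (R ∘ y)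
  ∑V-nodes R Rs≡0 Rt≡0 = begin
    R s + (R t + sumℚ (map R (xs ++ (ys ++ []))))  ≡⟨ cong₂ (λ a b → a + (b + sumℚ (map R (xs ++ (ys ++ []))))) Rs≡0 Rt≡0 ⟩
    0ℚ + (0ℚ + sumℚ (map R (xs ++ (ys ++ []))))    ≡⟨ trans (ℚ.+-identityˡ _) (ℚ.+-identityˡ _) ⟩
    sumℚ (map R (xs ++ (ys ++ [])))                ≡⟨ cong (λ zs → sumℚ (map R (xs ++ zs))) (++-identityʳ ys) ⟩
    sumℚ (map R (xs ++ ys))                        ≡⟨ cong sumℚ (map-++ R xs ys) ⟩
    sumℚ (map R xs ++ map R ys)                    ≡⟨ sumℚ-++ (map R xs) (map R ys) ⟩
    sumℚ (map R xs) + sumℚ (map R ys)              ≡⟨ cong₂ _+_ (node-sum zero) (node-sum (suc zero)) ⟩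
    ∑ (R ∘ x) + ∑ (R ∘ y)                          ∎
    where
    open ≡-Reasoning
    xs ys : List (Vertex 2 k)
    xs = map x (allFin k)
    ys = map y (allFin k)
    node-sum : ∀ v → sumℚ (map R (map (node v) (allFin k))) ≡ ∑ (R ∘ node v)
    node-sum v = begin
      sumℚ (map R (map (node v) (allFin k)))  ≡⟨ cong sumℚ (sym (map-∘ {g = R} {f = node v} (allFin k))) ⟩
      sumℚ (map (R ∘ node v) (allFin k))      ≡⟨ cong sumℚ (map-tabulate (λ i → i) (R ∘ node v)) ⟩
      sumℚ (tabulate (R ∘ node v))            ≡⟨ sumℚ-tabulate (R ∘ node v) ⟩
      ∑ (R ∘ node v)                          ∎

≟-refl : ∀ {n} (a : Fin n) → ⌊ a ≟ a ⌋ ≡ true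
≟-refl a with a ≟ a
... | yes _   = refl
... | no a≢a  = contradiction refl a≢a

≟-≢ : ∀ {n} {a b : Fin n} → ¬ a ≡ b → ⌊ a ≟ b ⌋ ≡ false
≟-≢ {a = a} {b} a≢b with a ≟ b
... | yes a≡b = contradiction a≡b a≢b
... | no _    = refl

≟-suc : ∀ {n} (a b : Fin n) → ⌊ suc a ≟ suc b ⌋ ≡ ⌊ a ≟ b ⌋
≟-suc a b with a ≟ b
... | yes _ = refl
... | no _  = refl

∑-select : ∀ {n} (c : Fin n → Bool) (a : Fin n) → ∑ (λ j → ½[ c j ∧ ⌊ a ≟ j ⌋ ]) ≡ ½[ c a ]
∑-select c a = trans (∑-single _ a off-a) (cong ½[_] (trans (cong (c a ∧_) (≟-refl a)) (∧-identityʳ (c a))))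
  where
  off-a : ∀ j → ¬ j ≡ a → ½[ c j ∧ ⌊ a ≟ j ⌋ ] ≡ 0ℚ
  off-a j j≢a = cong ½[_] (trans (cong (c j ∧_) (≟-≢ (λ a≡j → j≢a (sym a≡j)))) (∧-zeroʳ (c j)))

cutEdges : ∀ {k} (σ τ : Fin k → Fin k) (p q : Fin k → Bool) → ℕ
cutEdges σ τ p q = count (λ i → p i ∧ not (q (τ i))) ℕ.+ count (λ j → q j ∧ not (p (σ j)))

module Matching {k : ℕ} (σ τ : Fin k → Fin k) where
  open Vertices {k}

  edge : Vertex 2 k → Vertex 2 k → Bool
  edge (node zero i)       (node (suc zero) j) = ⌊ τ i ≟ j ⌋
  edge (node (suc zero) j) (node zero i)       = ⌊ σ j ≟ i ⌋
  edge _                   _                   = false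

  network : Network 2 k
  network = record { cap = λ u w → ½[ edge u w ] ; capNonneg = λ u w → ½[]-nonneg (edge u w) }

  module _ (S : VSet 2 k) where
    crossing : Vertex 2 k → Vertex 2 k → ℚ
    crossing u w = if S u ∧ not (S w) then ½[ edge u w ] else 0ℚ

    crossing-½ : ∀ u w → crossing u w ≡ ½[ (S u ∧ not (S w)) ∧ edge u w ]
    crossing-½ u w with S u ∧ not (S w)
    ... | true  = refl
    ... | false = refl

    crossing-nonedge : ∀ u w → edge u w ≡ false → crossing u w ≡ 0ℚ
    crossing-nonedge u w no-edge = trans (crossing-½ u w) (cong ½[_] (trans (cong (_ ∧_) no-edge) (∧-zeroʳ _)))

    out : Vertex 2 k → ℚ
    out u = ∑V (crossing u)

    out-terminal : ∀ u → (∀ w → edge u w ≡ false) → out u ≡ 0ℚ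
    out-terminal u no-edges = ∑V-zero (crossing u) (λ w → crossing-nonedge u w (no-edges w))

    out-x : ∀ i → out (x i) ≡ ½[ S (x i) ∧ not (S (y (τ i))) ]
    out-x i = begin
      out (x i)                                                ≡⟨ ∑V-nodes (crossing (x i)) (crossing-nonedge (x i) s refl) (crossing-nonedge (x i) t refl) ⟩
      ∑ (crossing (x i) ∘ x) + ∑ (crossing (x i) ∘ y)          ≡⟨ cong₂ _+_ (∑-zero (crossing (x i) ∘ x) (λ m → crossing-nonedge (x i) (x m) refl))
                                                                            (∑-cong {f = crossing (x i) ∘ y} (λ j → crossing-½ (x i) (y j))) ⟩
      0ℚ + ∑ (λ j → ½[ (S (x i) ∧ not (S (y j))) ∧ ⌊ τ i ≟ j ⌋ ]) ≡⟨ ℚ.+-identityˡ _ ⟩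
      ∑ (λ j → ½[ (S (x i) ∧ not (S (y j))) ∧ ⌊ τ i ≟ j ⌋ ])      ≡⟨ ∑-select (λ j → S (x i) ∧ not (S (y j))) (τ i) ⟩
      ½[ S (x i) ∧ not (S (y (τ i))) ]                         ∎
      where open ≡-Reasoning

    out-y : ∀ j → out (y j) ≡ ½[ S (y j) ∧ not (S (x (σ j))) ]
    out-y j = begin
      out (y j)                                                ≡⟨ ∑V-nodes (crossing (y j)) (crossing-nonedge (y j) s refl) (crossing-nonedge (y j) t refl) ⟩
      ∑ (crossing (y j) ∘ x) + ∑ (crossing (y j) ∘ y)          ≡⟨ cong₂ _+_ (∑-cong {f = crossing (y j) ∘ x} (λ i → crossing-½ (y j) (x i)))
                                                                            (∑-zero (crossing (y j) ∘ y) (λ m → crossing-nonedge (y j) (y m) refl)) ⟩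
      ∑ (λ i → ½[ (S (y j) ∧ not (S (x i))) ∧ ⌊ σ j ≟ i ⌋ ]) + 0ℚ ≡⟨ ℚ.+-identityʳ _ ⟩
      ∑ (λ i → ½[ (S (y j) ∧ not (S (x i))) ∧ ⌊ σ j ≟ i ⌋ ])      ≡⟨ ∑-select (λ i → S (y j) ∧ not (S (x i))) (σ j) ⟩
      ½[ S (y j) ∧ not (S (x (σ j))) ]                         ∎
      where open ≡-Reasoning

    capacity-cutEdges : capacity network S ≡ halves (cutEdges σ τ (S ∘ x) (S ∘ y))
    capacity-cutEdges = begin
      capacity network S                          ≡⟨ ∑V-concatMap crossing ⟩
      ∑V out                                      ≡⟨ ∑V-nodes out (out-terminal s (λ _ → refl)) (out-terminal t (λ _ → refl)) ⟩
      ∑ (out ∘ x) + ∑ (out ∘ y)                   ≡⟨ cong₂ _+_ (∑-cong {f = out ∘ x} out-x) (∑-cong {f = out ∘ y} out-y) ⟩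
      ∑ (½[_] ∘ leaves-x) + ∑ (½[_] ∘ leaves-y)   ≡⟨ cong₂ _+_ (∑-½[] leaves-x) (∑-½[] leaves-y) ⟩
      halves (count leaves-x) + halves (count leaves-y) ≡⟨ sym (halves-+ (count leaves-x) (count leaves-y)) ⟩
      halves (cutEdges σ τ (S ∘ x) (S ∘ y))       ∎
      where
      open ≡-Reasoning
      leaves-x leaves-y : Fin k → Bool
      leaves-x i = S (x i) ∧ not (S (y (τ i)))
      leaves-y j = S (y j) ∧ not (S (x (σ j)))

allB-true : ∀ {A : Set} {n} (P : A → Bool) (f : Fin n → A) → allB P (tabulate f) ≡ true → ∀ m → P (f m) ≡ true
allB-true P f all≡true zero    = ∧-conicalˡ _ _ all≡true
allB-true P f all≡true (suc m) = allB-true P (f ∘ suc) (∧-conicalʳ _ _ all≡true) m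

allB-false : ∀ {A : Set} {n} (P : A → Bool) (f : Fin n → A) → allB P (tabulate f) ≡ false → ∃ λ m → P (f m) ≡ false
allB-false {n = ℕ.suc n} P f all≡false with P (f zero) in P₀
... | false = zero , P₀
... | true  = let (m , Pm) = allB-false P (f ∘ suc) all≡false in suc m , Pm

alone : ∀ {k} → (Fin k → Bool) → Fin k → Bool
alone {k} p i = allB (λ j → ⌊ j ≟ i ⌋ ∨ not (p j)) (allFin k)

-- sole p i: i is the unique element of p.  The cut ν S keeps the part of S on
-- a variable v exactly when it is a singleton: ν S ∘ node v is sole (S ∘ node v).
sole : ∀ {k} → (Fin k → Bool) → Fin k → Bool
sole p i = p i ∧ alone p i

module _ {k} (p : Fin k → Bool) where
  sole⇒member : ∀ {a} → sole p a ≡ true → p a ≡ true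
  sole⇒member = ∧-conicalˡ _ _

  sole⇒only : ∀ {a} → sole p a ≡ true → ∀ i → ¬ i ≡ a → p i ≡ false
  sole⇒only {a} sole-a i i≢a = not-injective (begin
    not (p i)                  ≡⟨ sym (∨-identityˡ (not (p i))) ⟩
    false ∨ not (p i)          ≡⟨ cong (_∨ not (p i)) (sym (≟-≢ i≢a)) ⟩
    ⌊ i ≟ a ⌋ ∨ not (p i)      ≡⟨ allB-true (λ j → ⌊ j ≟ a ⌋ ∨ not (p j)) (λ j → j) (∧-conicalʳ _ _ sole-a) i ⟩
    true                       ∎)
    where open ≡-Reasoning

  sole-off : ∀ {i} → p i ≡ false → sole p i ≡ false
  sole-off p-i = cong (_∧ alone p _) p-i

  sole-singleton : ∀ {a} → sole p a ≡ true → ∀ i → sole p i ≡ p i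
  sole-singleton {a} sole-a i with i ≟ a
  ... | yes refl = trans sole-a (sym (sole⇒member sole-a))
  ... | no i≢a   = trans (sole-off (sole⇒only sole-a i i≢a)) (sym (sole⇒only sole-a i i≢a))

  not-sole : ∀ {i} → sole p i ≡ false → p i ≡ true → ∃ λ m → ¬ m ≡ i × p m ≡ true
  not-sole {i} not-sole-i p-i with allB-false (λ j → ⌊ j ≟ i ⌋ ∨ not (p j)) (λ j → j) (subst (λ b → b ∧ alone p i ≡ false) p-i not-sole-i)
  ... | m , witness = m , m≢i , not-injective (∨-conicalʳ _ _ witness)
    where
    m≢i : ¬ m ≡ i
    m≢i refl = contradiction (trans (sym (≟-refl m)) (∨-conicalˡ _ _ witness)) (λ ())

  sole-cases : (∃ λ a → sole p a ≡ true) ⊎ (∀ i → sole p i ≡ false)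
  sole-cases with any? (λ a → sole p a Bool.≟ true)
  ... | yes found = inj₁ found
  ... | no none   = inj₂ (λ i → ¬-not (λ sole-i → none (i , sole-i)))

cutEdges-cong : ∀ {k} (σ τ : Fin k → Fin k) {p p′ q q′ : Fin k → Bool} →
                (∀ i → p i ≡ p′ i) → (∀ j → q j ≡ q′ j) → cutEdges σ τ p q ≡ cutEdges σ τ p′ q′
cutEdges-cong σ τ p≗p′ q≗q′ =
  cong₂ ℕ._+_ (count-cong (λ i → cong₂ (λ b c → b ∧ not c) (p≗p′ i) (q≗q′ (τ i))))
              (count-cong (λ j → cong₂ (λ b c → b ∧ not c) (q≗q′ j) (p≗p′ (σ j))))

cutEdges-swap : ∀ {k} (σ τ : Fin k → Fin k) (p q : Fin k → Bool) → cutEdges σ τ p q ≡ cutEdges τ σ q p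
cutEdges-swap σ τ p q = ℕ.+-comm (count (λ i → p i ∧ not (q (τ i)))) (count (λ j → q j ∧ not (p (σ j))))

-- If ν keeps the singleton {a} on x and empties y, the restricted cut has at
-- most the one edge leaving x_a, while the original cut has at least one edge:
-- either x_a → y_{τ a} leaves it, or y_{τ a} is accompanied by some y_l whose
-- partner x_{σ l} ≠ x_a lies outside the cut.
cutEdges-ν-one-sided : ∀ {k} (σ τ : Fin k → Fin k) → (∀ j → τ (σ j) ≡ j) →
                       (p q : Fin k → Bool) (a : Fin k) → sole p a ≡ true → (∀ j → sole q j ≡ false) →
                       cutEdges σ τ (sole p) (sole q) ℕ.≤ cutEdges σ τ p q
cutEdges-ν-one-sided σ τ τσ p q a sole-a q-emptied = begin
  count (λ i → sole p i ∧ not (sole q (τ i))) ℕ.+ count (λ j → sole q j ∧ not (sole p (σ j)))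
    ≤⟨ ℕ.+-mono-≤ (count-≤1 _ a (λ i i≢a → cong (_∧ not (sole q (τ i))) (sole-off p (sole⇒only p sole-a i i≢a))))
                  (ℕ.≤-reflexive (count-none _ (λ j → cong (_∧ not (sole p (σ j))) (q-emptied j)))) ⟩
  1 ℕ.+ 0
    ≤⟨ edge-leaves ⟩
  cutEdges σ τ p q ∎
  where
  open ℕ.≤-Reasoning
  edge-leaves : 1 ℕ.≤ cutEdges σ τ p q
  edge-leaves with q (τ a) in q-τa
  ... | false = ℕ.≤-trans (count-≥1 _ a (subst (λ b → b ∧ not (q (τ a)) ≡ true) (sym (sole⇒member p sole-a))
                                           (cong not q-τa))) (ℕ.m≤m+n _ _)
  ... | true with not-sole q (q-emptied (τ a)) q-τa
  ... | l , l≢τa , q-l = ℕ.≤-trans (count-≥1 _ l x-partner-out) (ℕ.m≤n+m _ _)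
    where
    x-partner-out : q l ∧ not (p (σ l)) ≡ true
    x-partner-out rewrite q-l | sole⇒only p sole-a (σ l) (λ σl≡a → l≢τa (trans (sym (τσ l)) (cong τ σl≡a))) = refl

cutEdges-ν : ∀ {k} (σ τ : Fin k → Fin k) → (∀ j → τ (σ j) ≡ j) → (∀ i → σ (τ i) ≡ i) →
             (p q : Fin k → Bool) → cutEdges σ τ (sole p) (sole q) ℕ.≤ cutEdges σ τ p q
cutEdges-ν σ τ τσ στ p q with sole-cases p | sole-cases q
... | inj₁ (a , sole-a) | inj₁ (b , sole-b) =
  ℕ.≤-reflexive (cutEdges-cong σ τ (sole-singleton p sole-a) (sole-singleton q sole-b))
... | inj₁ (a , sole-a) | inj₂ q-emptied = cutEdges-ν-one-sided σ τ τσ p q a sole-a q-emptied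
... | inj₂ p-emptied | inj₁ (b , sole-b) =
  subst₂ ℕ._≤_ (sym (cutEdges-swap σ τ (sole p) (sole q))) (sym (cutEdges-swap σ τ p q))
         (cutEdges-ν-one-sided τ σ στ q p b sole-b p-emptied)
... | inj₂ p-emptied | inj₂ q-emptied =
  ℕ.≤-trans (ℕ.≤-reflexive (cong₂ ℕ._+_ (count-none _ (λ i → cong (_∧ not (sole q (τ i))) (p-emptied i)))
                                         (count-none _ (λ j → cong (_∧ not (sole p (σ j))) (q-emptied j)))))
            ℕ.z≤n

-- chosen a i: the value a ∈ D' = {0} ∪ D selects the node i, i.e. a = i + 1.
-- The cut S_φ has x-part chosen (φ x) and y-part chosen (φ y).
chosen : ∀ {k} → Fin (ℕ.suc k) → Fin k → Bool
chosen a i = ⌊ a ≟ suc i ⌋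

count-chosen-zero : ∀ {k} (r : Fin k → Bool) → count (λ i → chosen zero i ∧ r i) ≡ 0
count-chosen-zero r = count-none (λ i → chosen zero i ∧ r i) (λ i → refl)

count-chosen-suc : ∀ {k} (a : Fin k) (r : Fin k → Bool) → count (λ i → chosen (suc a) i ∧ r i) ≡ 𝟙 (r a)
count-chosen-suc a r = trans (count-single _ a (λ i i≢a → cong (_∧ r i) (≟-≢ (λ a≡i → i≢a (sym (suc-injective a≡i))))))
                             (cong (λ b → 𝟙 (b ∧ r a)) (≟-refl (suc a)))

module Permuted {k : ℕ} (π : Permutation′ k) where
  σ τ : Fin k → Fin k
  σ j = π ⟨$⟩ʳ j
  τ i = π ⟨$⟩ˡ i

  open Matching σ τ
  open Vertices {k}

  matched-sym : ∀ a b → ⌊ b ≟ τ a ⌋ ≡ ⌊ a ≟ σ b ⌋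
  matched-sym a b with a ≟ σ b
  ... | yes refl = trans (cong (λ c → ⌊ b ≟ c ⌋) (inverseˡ π)) (≟-refl b)
  ... | no a≢σb  = ≟-≢ (λ b≡τa → a≢σb (trans (sym (inverseʳ π)) (cong σ (sym b≡τa))))

  y-out x-out : Fin (ℕ.suc k) → Fin k → Bool
  y-out b i = not (chosen b (τ i))
  x-out a j = not (chosen a (σ j))

  cutEdges-chosen : ∀ a b → halves (cutEdges σ τ (chosen a) (chosen b)) ≡ fπ π a b
  cutEdges-chosen zero    zero    = cong halves (cong₂ ℕ._+_ (count-chosen-zero (y-out zero)) (count-chosen-zero (x-out zero)))
  cutEdges-chosen (suc a) zero    = cong halves (cong₂ ℕ._+_ (count-chosen-suc a (y-out zero)) (count-chosen-zero (x-out (suc a))))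
  cutEdges-chosen zero    (suc b) = cong halves (cong₂ ℕ._+_ (count-chosen-zero (y-out (suc b))) (count-chosen-suc b (x-out zero)))
  cutEdges-chosen (suc a) (suc b) = begin
    halves (cutEdges σ τ (chosen (suc a)) (chosen (suc b)))
      ≡⟨ cong halves (cong₂ ℕ._+_ (count-chosen-suc a (y-out (suc b))) (count-chosen-suc b (x-out (suc a)))) ⟩
    halves (𝟙 (not ⌊ suc b ≟ suc (τ a) ⌋) ℕ.+ 𝟙 (not ⌊ suc a ≟ suc (σ b) ⌋))
      ≡⟨ cong₂ (λ m m′ → halves (𝟙 (not m) ℕ.+ 𝟙 (not m′))) (trans (≟-suc b (τ a)) (matched-sym a b)) (≟-suc a (σ b)) ⟩
    halves (𝟙 (not ⌊ a ≟ σ b ⌋) ℕ.+ 𝟙 (not ⌊ a ≟ σ b ⌋))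
      ≡⟨ both-or-neither ⌊ a ≟ σ b ⌋ ⟩
    fπ π (suc a) (suc b) ∎
    where
    open ≡-Reasoning
    both-or-neither : ∀ m → halves (𝟙 (not m) ℕ.+ 𝟙 (not m)) ≡ (if m then 0ℚ else 1ℚ)
    both-or-neither true  = refl
    both-or-neither false = refl

  represents : Represents network (fπ-on π)
  represents φ = trans (capacity-cutEdges (Sφ φ)) (cutEdges-chosen (φ zero) (φ (suc zero)))

  -- c(ν S) ≤ c(S) holds for every vertex set S, cut or not.
  k-submodular : IsKSubmodular network
  k-submodular S _ = subst₂ _≤_ (sym (capacity-cutEdges (ν S))) (sym (capacity-cutEdges S))
                            (halves-mono (cutEdges-ν σ τ (λ j → inverseˡ π) (λ i → inverseʳ π) (S ∘ x) (S ∘ y)))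

lemma6p9 : (k : ℕ) (π : Permutation′ k) → KSubmodularRepresentable 2 k (fπ-on π)
lemma6p9 k π = network , k-submodular , represents
  where open Permuted π
        open Matching σ τ using (network)
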